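{- Let $B$ be a type and $f:\mathbb{N}\to B^\nu$ be increasing, i.e. $\forall n,m.\,n<m\to f\,n\sqsubseteq f\,m$. For all $b:B$ and $n:\mathbb{N}$, if $f\,n\downarrow b$ then $\mathsf{parallel\_search}\,f\downarrow b$.
   Context: Work in an intensional constructive dependent type theory with inductive and coinductive types. For a type $B$, $B^\nu$ is the coinductive type with constructors $\mathsf{return}:B\to B^\nu$ and $\mathsf{step}:B^\nu\to B^\nu$; $\mathsf{step}^\infty=\mathsf{step}\,\mathsf{step}^\infty$. Convergence $x\downarrow b$ is inductive: $\mathsf{return}\,b\downarrow b$; $x\downarrow b\Rightarrow\mathsf{step}\,x\downarrow b$. The convergence order $x\sqsubseteq y$ is coinductive with rules: if $x\downarrow b$ and $y\downarrow b$ then $x\sqsubseteq y$; if $x\sqsubseteq y$ then $\mathsf{step}\,x\sqsubseteq\mathsf{step}\,y$; if $x\sqsubseteq y$ then $\mathsf{step}\,x\sqsubseteq y$. $\mathsf{fstconv}:B^\nu\to B^\nu\to B^\nu$ is defined corecursively by $\mathsf{fstconv}\,(\mathsf{return}\,b)\,y=\mathsf{return}\,b$; $\mathsf{fstconv}\,(\mathsf{step}\,x)\,(\mathsf{return}\,b)=\mathsf{return}\,b$; $\mathsf{fstconv}\,(\mathsf{step}\,x)\,(\mathsf{step}\,y)=\mathsf{step}(\mathsf{fstconv}\,x\,y)$. $\mathsf{psa}:(\mathbb{N}\to B^\nu)\to\mathbb{N}\to B^\nu\to B^\nu$ is defined corecursively by $\mathsf{psa}\,f\,n\,(\mathsf{return}\,b)=\mathsf{return}\,b$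 and $\mathsf{psa}\,f\,n\,(\mathsf{step}\,x)=\mathsf{step}(\mathsf{psa}\,f\,(n+1)\,(\mathsf{fstconv}\,x\,(f\,n)))$, and $\mathsf{parallel\_search}\,f=\mathsf{psa}\,f\,0\,\mathsf{step}^\infty$. -}

module Defs where

-- We encode the coinductive type B^ν (constructors
-- return : B → B^ν, step : B^ν → B^ν) by its tree of observations: an element
-- x is the function sending a depth k to the shape of the node reached after
-- k unfoldings: `just b` means that node is `return b`, `nothing` means it is
-- `step _`.  (Entries beyond the first `just` are unreachable and ignored by
-- every notion below.)  Corecursive definitions become recursion on the depth,
-- and the coinductive order ⊑ is its greatest fixed point, defined as
-- "contained in some post-fixed point (bisimulation-style) relation".

open import Level using (Level; suc; _⊔_)
open import Data.Nat using (ℕ; zero; _<_) renaming (suc to sucℕ)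
open import Data.Maybe using (Maybe; just; nothing)
open import Data.Product using (Σ; _×_; _,_)
open import Relation.Binary.PropositionalEquality using (_≡_)

Delay : {ℓ : Level} → Set ℓ → Set ℓ
Delay B = ℕ → Maybe B

module _ {ℓ : Level} {B : Set ℓ} where

  return : B → Delay B
  return b _ = just b

  step : Delay B → Delay B
  step x zero     = nothing
  step x (sucℕ k) = x k

  tail : Delay B → Delay B
  tail x k = x (sucℕ k)

  -- step^∞ = step step^∞
  step∞ : Delay B
  step∞ _ = nothing

  data _↓_ : Delay B → B → Set ℓ where
    conv-return : ∀ {x b} → x zero ≡ just b → x ↓ b
    conv-step   : ∀ {x b} → x zero ≡ nothing → tail x ↓ b → x ↓ b

  data ⊑-Rules (R : Delay B → Delay B → Set ℓ) : Delay B → Delay B → Set ℓ where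
    ⊑-conv  : ∀ {x y b} → x ↓ b → y ↓ b → ⊑-Rules R x y
    ⊑-step  : ∀ {x y} → x zero ≡ nothing → y zero ≡ nothing
              → R (tail x) (tail y) → ⊑-Rules R x y
    ⊑-stepˡ : ∀ {x y} → x zero ≡ nothing → R (tail x) y → ⊑-Rules R x y

  _⊑_ : Delay B → Delay B → Set (suc ℓ)
  x ⊑ y = Σ (Delay B → Delay B → Set ℓ) λ R →
            (∀ u v → R u v → ⊑-Rules R u v) × R x y

  -- fstconv (return b) y = return b
  -- fstconv (step x) (return b) = return b
  -- fstconv (step x) (step y) = step (fstconv x y)
  fstconv : Delay B → Delay B → Delay B
  fstconv x y k with x zero | y zero
  fstconv x y k        | just b  | _       = just b
  fstconv x y k        | nothing | just b  = just b
  fstconv x y zero     | nothing | nothing = nothing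
  fstconv x y (sucℕ k) | nothing | nothing = fstconv (tail x) (tail y) k

  -- psa f n (return b) = return b
  -- psa f n (step x) = step (psa f (n+1) (fstconv x (f n)))
  psa : (ℕ → Delay B) → ℕ → Delay B → Delay B
  psa f n x k with x zero
  psa f n x k        | just b  = just b
  psa f n x zero     | nothing = nothing
  psa f n x (sucℕ k) | nothing = psa f (sucℕ n) (fstconv (tail x) (f n)) k

  parallel-search : (ℕ → Delay B) → Delay B
  parallel-search f = psa f 0 step∞

  Increasing : (ℕ → Delay B) → Set (suc ℓ)
  Increasing f = ∀ n m → n < m → f n ⊑ f m

-- Convergence of the search and the value it converges to are handled separately.
-- While its accumulator has not converged, psa f m takes a step, moves to stage m + 1
-- and races the accumulator against f m; so after n steps it races against f n, and it
-- converges whenever f n does. Conversely, every value it returns is returned by some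
-- f i. Along an increasing chain all convergent elements have the same value, since ⊑
-- transports convergence and convergence is deterministic; so that value is b.
module Submission where

open import Defs
open import Level using (Level)
open import Data.Nat using (ℕ; zero; suc; _+_)
open import Data.Nat.Properties using (<-cmp; +-suc; +-identityʳ)
open import Data.Maybe using (just; nothing)
open import Data.Maybe.Properties using (just-injective)
open import Data.Product using (∃-syntax; _,_)
open import Data.Sum using (_⊎_; inj₁; inj₂; [_,_])
import Data.Sum as Sum
open import Data.Empty using (⊥-elim)
open import Function using (_∘_; id)
open import Relation.Nullary using (¬_)
open import Relation.Binary.Definitions using (tri<; tri≈; tri>)
open import Relation.Binary.PropositionalEquality
  using (_≡_; _≢_; refl; sym; trans; subst; _≗_)

module _ {ℓ : Level} {B : Set ℓ} where

  private
    variable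
      x y : Delay B
      b c : B
      k m : ℕ

  nothing≢just : nothing ≢ just b
  nothing≢just ()

  ↓-unique : x ↓ b → x ↓ c → b ≡ c
  ↓-unique (conv-return p) (conv-return q) = just-injective (trans (sym p) q)
  ↓-unique (conv-return p) (conv-step q _) = ⊥-elim (nothing≢just (trans (sym q) p))
  ↓-unique (conv-step p _) (conv-return q) = ⊥-elim (nothing≢just (trans (sym p) q))
  ↓-unique (conv-step _ d) (conv-step _ e) = ↓-unique d e

  step∞-diverges : ¬ step∞ ↓ b
  step∞-diverges (conv-step _ d) = step∞-diverges d

  ⊑-preserves-↓ : x ⊑ y → x ↓ b → y ↓ b
  ⊑-preserves-↓ {b = b} (R , postfixed , xRy) d = go d xRy
    where
    go : ∀ {x y} → x ↓ b → R x y → y ↓ b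
    go d r with postfixed _ _ r | d
    ... | ⊑-conv dx dy   | _              = subst (_ ↓_) (↓-unique dx d) dy
    ... | ⊑-step p _ _   | conv-return q  = ⊥-elim (nothing≢just (trans (sym p) q))
    ... | ⊑-step _ q r′  | conv-step _ d′ = conv-step q (go d′ r′)
    ... | ⊑-stepˡ p _    | conv-return q  = ⊥-elim (nothing≢just (trans (sym p) q))
    ... | ⊑-stepˡ _ r′   | conv-step _ d′ = go d′ r′

  Increasing-↓-unique : (f : ℕ → Delay B) → Increasing f →
                        ∀ {i n} → f i ↓ c → f n ↓ b → c ≡ b
  Increasing-↓-unique f inc {i} {n} di dn with <-cmp i n
  ... | tri< i<n _ _  = ↓-unique (⊑-preserves-↓ (inc i n i<n) di) dn
  ... | tri≈ _ refl _ = ↓-unique di dn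
  ... | tri> _ _ n<i  = ↓-unique di (⊑-preserves-↓ (inc n i n<i) dn)

  -- Convergence to b within at most (not exactly) k steps.
  data _↓[_]_ : Delay B → ℕ → B → Set ℓ where
    now   : x zero ≡ just b → x ↓[ k ] b
    later : x zero ≡ nothing → tail x ↓[ k ] b → x ↓[ suc k ] b

  _⇓[_] : Delay B → ℕ → Set ℓ
  x ⇓[ k ] = ∃[ b ] x ↓[ k ] b

  ↓[]⇒↓ : x ↓[ k ] b → x ↓ b
  ↓[]⇒↓ (now p)     = conv-return p
  ↓[]⇒↓ (later p d) = conv-step p (↓[]⇒↓ d)

  ↓⇒↓[] : x ↓ b → ∃[ k ] x ↓[ k ] b
  ↓⇒↓[] (conv-return p) = 0 , now p
  ↓⇒↓[] (conv-step p d) with ↓⇒↓[] d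
  ... | k , dₖ = suc k , later p dₖ

  ↓[]-resp-≗ : x ≗ y → x ↓[ k ] b → y ↓[ k ] b
  ↓[]-resp-≗ x≗y (now p)     = now (trans (sym (x≗y zero)) p)
  ↓[]-resp-≗ x≗y (later p d) =
    later (trans (sym (x≗y zero)) p) (↓[]-resp-≗ (x≗y ∘ suc) d)

  ⇓[]-resp-≗ : x ≗ y → x ⇓[ k ] → y ⇓[ k ]
  ⇓[]-resp-≗ x≗y (b , d) = b , ↓[]-resp-≗ x≗y d

  ↓[]-resp-return : x zero ≡ just c → y zero ≡ just c → x ↓[ k ] b → y ↓[ k ] b
  ↓[]-resp-return p q (now r)     = now (trans q (trans (sym p) r))
  ↓[]-resp-return p q (later r _) = ⊥-elim (nothing≢just (trans (sym r) p))

  step-¬↓[0] : ¬ step x ↓[ 0 ] b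
  step-¬↓[0] (now ())

  step-↓[]⁻¹ : step x ↓[ suc k ] b → x ↓[ k ] b
  step-↓[]⁻¹ (later _ d) = d

  ¬⇓[0] : x zero ≡ nothing → ¬ x ⇓[ 0 ]
  ¬⇓[0] p (b , now q) = nothing≢just (trans (sym p) q)

  ⇓[]-tail : x zero ≡ nothing → x ⇓[ suc k ] → tail x ⇓[ k ]
  ⇓[]-tail p (b , now q)     = ⊥-elim (nothing≢just (trans (sym p) q))
  ⇓[]-tail p (b , later _ d) = b , d

  step-⇓[] : x ⇓[ k ] → step x ⇓[ suc k ]
  step-⇓[] (b , d) = b , later refl d

  data Head (x : Delay B) : Set ℓ where
    returns : x zero ≡ just b → Head x
    steps   : x zero ≡ nothing → Head x

  head : (x : Delay B) → Head x
  head x with x zero in p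
  ... | just b  = returns p
  ... | nothing = steps p

  fstconv-returnˡ : (x y : Delay B) → x zero ≡ just c → fstconv x y ≗ return c
  fstconv-returnˡ x y p k rewrite p = refl

  fstconv-returnʳ : (x y : Delay B) → x zero ≡ nothing → y zero ≡ just c →
                    fstconv x y ≗ return c
  fstconv-returnʳ x y p q k rewrite p | q = refl

  fstconv-step : (x y : Delay B) → x zero ≡ nothing → y zero ≡ nothing →
                 fstconv x y ≗ step (fstconv (tail x) (tail y))
  fstconv-step x y p q zero    rewrite p | q = refl
  fstconv-step x y p q (suc k) rewrite p | q = refl

  fstconv-↓[]⁻¹ : fstconv x y ↓[ k ] b → x ↓[ k ] b ⊎ y ↓[ k ] b
  fstconv-↓[]⁻¹ {x} {y} {k} d with head x | head y | k
  ... | returns p | _         | _     =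
    inj₁ (↓[]-resp-return (fstconv-returnˡ x y p zero) p d)
  ... | steps p   | returns q | _     =
    inj₂ (↓[]-resp-return (fstconv-returnʳ x y p q zero) q d)
  ... | steps p   | steps q   | zero  =
    ⊥-elim (step-¬↓[0] (↓[]-resp-≗ (fstconv-step x y p q) d))
  ... | steps p   | steps q   | suc k =
    Sum.map (later p) (later q)
      (fstconv-↓[]⁻¹ (step-↓[]⁻¹ (↓[]-resp-≗ (fstconv-step x y p q) d)))

  fstconv-⇓[] : x ⇓[ k ] ⊎ y ⇓[ k ] → fstconv x y ⇓[ k ]
  fstconv-⇓[] {x} {k} {y} h with head x | head y | k
  ... | returns p | _         | _     = _ , now (fstconv-returnˡ x y p zero)
  ... | steps p   | returns q | _     = _ , now (fstconv-returnʳ x y p q zero)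
  ... | steps p   | steps q   | zero  = ⊥-elim ([ ¬⇓[0] p , ¬⇓[0] q ] h)
  ... | steps p   | steps q   | suc k =
    ⇓[]-resp-≗ (sym ∘ fstconv-step x y p q)
      (step-⇓[] (fstconv-⇓[] (Sum.map (⇓[]-tail p) (⇓[]-tail q) h)))

  module _ (f : ℕ → Delay B) where

    psa-return : ∀ m (x : Delay B) → x zero ≡ just c → psa f m x ≗ return c
    psa-return m x p k rewrite p = refl

    psa-step : ∀ m (x : Delay B) → x zero ≡ nothing →
               psa f m x ≗ step (psa f (suc m) (fstconv (tail x) (f m)))
    psa-step m x p zero    rewrite p = refl
    psa-step m x p (suc k) rewrite p = refl

    psa-↓[]⁻¹ : psa f m x ↓[ k ] b → x ↓[ k ] b ⊎ ∃[ i ] f i ↓ b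
    psa-↓[]⁻¹ {m} {x} {k} d with head x | k
    ... | returns p | _     = inj₁ (↓[]-resp-return (psa-return m x p zero) p d)
    ... | steps p   | zero  = ⊥-elim (step-¬↓[0] (↓[]-resp-≗ (psa-step m x p) d))
    ... | steps p   | suc k
      with psa-↓[]⁻¹ (step-↓[]⁻¹ (↓[]-resp-≗ (psa-step m x p) d))
    ...   | inj₁ d′  = Sum.map (later p) (λ d″ → m , ↓[]⇒↓ d″) (fstconv-↓[]⁻¹ d′)
    ...   | inj₂ fi↓ = inj₂ fi↓

    psa-step-⇓[] : ∀ m (x : Delay B) → x zero ≡ nothing →
                   psa f (suc m) (fstconv (tail x) (f m)) ⇓[ k ] →
                   psa f m x ⇓[ suc k ]
    psa-step-⇓[] m x p h = ⇓[]-resp-≗ (sym ∘ psa-step m x p) (step-⇓[] h)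

    psa-⇓[]-accumulator : x ⇓[ k ] → psa f m x ⇓[ k ]
    psa-⇓[]-accumulator {x} {k} {m} h with head x | k
    ... | returns p | _     = _ , now (psa-return m x p zero)
    ... | steps p   | zero  = ⊥-elim (¬⇓[0] p h)
    ... | steps p   | suc k =
      psa-step-⇓[] m x p (psa-⇓[]-accumulator (fstconv-⇓[] (inj₁ (⇓[]-tail p h))))

    psa-⇓[]-stage : ∀ j → f (j + m) ⇓[ k ] → psa f m x ⇓[ suc (j + k) ]
    psa-⇓[]-stage {m} {k} {x} j h with head x
    ... | returns p = _ , now (psa-return m x p zero)
    psa-⇓[]-stage {m} {k} {x} zero h | steps p =
      psa-step-⇓[] m x p (psa-⇓[]-accumulator (fstconv-⇓[] {x = tail x} (inj₂ h)))
    psa-⇓[]-stage {m} {k} {x} (suc j) h | steps p =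
      psa-step-⇓[] m x p
        (psa-⇓[]-stage {x = fstconv (tail x) (f m)} j (subst (_⇓[ k ] ∘ f) (sym (+-suc j m)) h))

    parallel-search-⇓[] : ∀ n → f n ⇓[ k ] → parallel-search f ⇓[ suc (n + k) ]
    parallel-search-⇓[] {k} n h =
      psa-⇓[]-stage {x = step∞} n (subst (_⇓[ k ] ∘ f) (sym (+-identityʳ n)) h)

    parallel-search-↓[]⁻¹ : parallel-search f ↓[ k ] b → ∃[ i ] f i ↓ b
    parallel-search-↓[]⁻¹ d =
      [ ⊥-elim ∘ step∞-diverges ∘ ↓[]⇒↓ , id ] (psa-↓[]⁻¹ {m = 0} {x = step∞} d)

lemma6p14 : {ℓ : Level} {B : Set ℓ} (f : ℕ → Delay B) → Increasing f →
            (b : B) (n : ℕ) → f n ↓ b → parallel-search f ↓ b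
lemma6p14 f inc b n fn↓b with ↓⇒↓[] fn↓b
... | k , fn↓[k]b with parallel-search-⇓[] f n (b , fn↓[k]b)
...   | c , search↓c with parallel-search-↓[]⁻¹ f search↓c
...     | _ , fi↓c =
  subst (parallel-search f ↓_) (Increasing-↓-unique f inc fi↓c fn↓b) (↓[]⇒↓ search↓c)
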